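{- Let $G$ be a simple graph, $p$ a pebble distribution on $G$ and $S$ a finite multiset of rubbling moves on $G$ that is balanced with $p$. If $t=(v,w\to u)\in S$ is such that $d^-_{T(G,S)}(v)=0=d^-_{T(G,S)}(w)$, then $t$ is executable from $p$, i.e. applying $t$ to $p$ yields a nonnegative pebble function.
   Context: A pebble function on $G$ is a function $p:V(G)\to\mathbb{Z}$; a pebble distribution is a nonnegative pebble function. If $\{v,u\}\in E(G)$, the pebbling move $(v,v\to u)$ decreases $p(v)$ by 2 and increases $p(u)$ by 1. If $v\ne w$ and $\{v,u\},\{w,u\}\in E(G)$, the strict rubbling move $(v,w\to u)$ decreases $p(v)$ and $p(w)$ by 1 and increases $p(u)$ by 1. A rubbling move is either of these. For a multiset $S$ of rubbling moves, $p_S$ is the result of applying all moves of $S$ to $p$ (order irrelevant). The transition digraph $T(G,S)$ is the directed multigraph on $V(G)$ in which each move $(v,w\to u)\in S$ contributes two directed edges $(v,u)$ and $(w,u)$; $d^-$ and $d^+$ denote in- and out-degree in it. $S$ is balanced with $p$ if $p_S(x)\ge 0$ for all $x\in V(G)$. -}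

module Defs where

open import Data.Nat using (ℕ)
open import Data.Fin using (Fin; _≟_)
open import Data.Integer using (ℤ; +_; _+_; _-_; _≤_)
open import Data.List using (List; []; _∷_; foldr; length; filter)
open import Data.Product using (_×_; _,_; proj₂)
open import Data.Bool using (if_then_else_)
open import Relation.Nullary using (¬_)
open import Relation.Nullary.Decidable using (⌊_⌋)
open import Relation.Binary.PropositionalEquality using (_≡_)
open import Level using (0ℓ; suc)

record SimpleGraph (n : ℕ) : Set₁ where
  field
    Adj   : Fin n → Fin n → Set
    sym   : ∀ {x y} → Adj x y → Adj y x
    irrefl : ∀ {x} → ¬ Adj x x
open SimpleGraph public

Vertex : ℕ → Set
Vertex n = Fin n

PebbleFunction : ℕ → Set
PebbleFunction n = Fin n → ℤ

IsPebbleDistribution : ∀ {n} → PebbleFunction n → Set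
IsPebbleDistribution p = ∀ x → + 0 ≤ p x

-- A rubbling move (v , w → u) with {v,u}, {w,u} edges.
-- If v ≡ w it is the pebbling move (v , v → u); otherwise a strict rubbling move.
record RubblingMove {n : ℕ} (G : SimpleGraph n) : Set where
  constructor move
  field
    src₁ : Fin n
    src₂ : Fin n
    tgt  : Fin n
    adj₁ : Adj G src₁ tgt
    adj₂ : Adj G src₂ tgt
open RubblingMove public

indicator : ∀ {n} → Fin n → Fin n → ℤ
indicator x y = if ⌊ x ≟ y ⌋ then + 1 else + 0

applyMove : ∀ {n} {G : SimpleGraph n} → RubblingMove G → PebbleFunction n → PebbleFunction n
applyMove t p x = p x - indicator x (src₁ t) - indicator x (src₂ t) + indicator x (tgt t)

-- p_S : apply all moves of the (finite) multiset S, represented as a list.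
applyMoves : ∀ {n} {G : SimpleGraph n} → List (RubblingMove G) → PebbleFunction n → PebbleFunction n
applyMoves S p = foldr applyMove p S

Balanced : ∀ {n} {G : SimpleGraph n} → List (RubblingMove G) → PebbleFunction n → Set
Balanced S p = ∀ x → + 0 ≤ applyMoves S p x

-- Transition digraph T(G,S): multiset of directed edges; each move (v,w→u)
-- contributes (v,u) and (w,u).
transitionEdges : ∀ {n} {G : SimpleGraph n} → List (RubblingMove G) → List (Fin n × Fin n)
transitionEdges [] = []
transitionEdges (t ∷ S) = (src₁ t , tgt t) ∷ (src₂ t , tgt t) ∷ transitionEdges S

inDegree : ∀ {n} {G : SimpleGraph n} → List (RubblingMove G) → Fin n → ℕ
inDegree S x = length (filter (λ e → proj₂ e ≟ x) (transitionEdges S))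

-- No move of S puts a pebble on a vertex of in-degree 0, so along S such a
-- vertex only loses pebbles, and in particular it loses at least what the
-- single move t takes from it: p_S(v) ≤ p_t(v). Balance gives 0 ≤ p_S(v),
-- hence 0 ≤ p_t(v), and likewise at w. Every other vertex can only gain
-- pebbles under t, so p_t is nonnegative there because p is.
module Submission where

open import Defs
open import Data.Nat using (ℕ)
open import Data.Integer using (ℤ; +_; -_; _+_; _-_; _≤_)
open import Data.Integer.Properties
  using (≤-refl; ≤-trans; +-monoˡ-≤; +-identityʳ; i-j≤i; i≤i+j)
open import Data.List using (List; _∷_; [])
open import Data.List.Membership.Propositional using (_∈_)
open import Data.List.Relation.Unary.Any using (here; there)
open import Data.Fin using (Fin; _≟_)
open import Data.Product using (_×_; _,_)
open import Data.Empty using (⊥-elim)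
open import Function using (_∘′_)
open import Data.Sum using (inj₁; inj₂)
open import Relation.Nullary using (yes; no)
open import Relation.Nullary.Decidable using (_⊎-dec_)
open import Relation.Binary.PropositionalEquality
  using (_≡_; _≢_; refl; ≢-sym)

private
  variable
    n : ℕ
    G : SimpleGraph n

indicator-≢ : {x y : Fin n} → x ≢ y → indicator x y ≡ + 0
indicator-≢ {x = x} {y} x≢y with x ≟ y
... | yes x≡y = ⊥-elim (x≢y x≡y)
... | no  _   = refl

i-indicator≤i : (i : ℤ) (x y : Fin n) → i - indicator x y ≤ i
i-indicator≤i i x y with x ≟ y
... | yes _ = i-j≤i i (+ 1)
... | no  _ = i-j≤i i (+ 0)

i≤i+indicator : (i : ℤ) (x y : Fin n) → i ≤ i + indicator x y
i≤i+indicator i x y with x ≟ y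
... | yes _ = i≤i+j i (+ 1)
... | no  _ = i≤i+j i (+ 0)

applyMove-mono : (t : RubblingMove G) {p q : PebbleFunction n} {x : Fin n} →
                 p x ≤ q x → applyMove t p x ≤ applyMove t q x
applyMove-mono t {x = x} =
  +-monoˡ-≤ (indicator x (tgt t)) ∘′ +-monoˡ-≤ (- indicator x (src₂ t)) ∘′
  +-monoˡ-≤ (- indicator x (src₁ t))

applyMove-≤ : (t : RubblingMove G) (p : PebbleFunction n) {x : Fin n} →
              tgt t ≢ x → applyMove t p x ≤ p x
applyMove-≤ t p {x} tgt≢x
  rewrite indicator-≢ (≢-sym tgt≢x)
        | +-identityʳ (p x - indicator x (src₁ t) - indicator x (src₂ t)) =
  ≤-trans (i-indicator≤i _ x (src₂ t)) (i-indicator≤i (p x) x (src₁ t))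

applyMove-≥ : (t : RubblingMove G) (p : PebbleFunction n) {x : Fin n} →
              x ≢ src₁ t → x ≢ src₂ t → p x ≤ applyMove t p x
applyMove-≥ t p {x} x≢v x≢w
  rewrite indicator-≢ x≢v | indicator-≢ x≢w
        | +-identityʳ (p x) | +-identityʳ (p x) =
  i≤i+indicator (p x) x (tgt t)

inDegree≡0-∷ : (s : RubblingMove G) (S : List (RubblingMove G)) {x : Fin n} →
             inDegree (s ∷ S) x ≡ 0 → tgt s ≢ x × inDegree S x ≡ 0
inDegree≡0-∷ s S {x} d with tgt s ≟ x
inDegree≡0-∷ s S {x} () | yes _
... | no tgt≢x with tgt s ≟ x
...   | yes tgt≡x = ⊥-elim (tgt≢x tgt≡x)
...   | no  _     = tgt≢x , d

applyMoves-≤ : (S : List (RubblingMove G)) (p : PebbleFunction n) {x : Fin n} →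
               inDegree S x ≡ 0 → applyMoves S p x ≤ p x
applyMoves-≤ []      p _ = ≤-refl
applyMoves-≤ (s ∷ S) p d with inDegree≡0-∷ s S d
... | tgt≢x , d′ = ≤-trans (applyMove-≤ s (applyMoves S p) tgt≢x) (applyMoves-≤ S p d′)

applyMoves-≤-applyMove : (S : List (RubblingMove G)) (p : PebbleFunction n)
                         {t : RubblingMove G} {x : Fin n} →
                         inDegree S x ≡ 0 → t ∈ S → applyMoves S p x ≤ applyMove t p x
applyMoves-≤-applyMove (s ∷ S) p d t∈S with inDegree≡0-∷ s S d
applyMoves-≤-applyMove (s ∷ S) p {x = x} d (here refl) | _ , d′ =
  applyMove-mono s {applyMoves S p} {p} {x} (applyMoves-≤ S p d′)
applyMoves-≤-applyMove (s ∷ S) p d (there t∈S) | tgt≢x , d′ =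
  ≤-trans (applyMove-≤ s (applyMoves S p) tgt≢x) (applyMoves-≤-applyMove S p d′ t∈S)

applyMove-nonneg-if-inDegree≡0 : (S : List (RubblingMove G)) (p : PebbleFunction n)
                                 {t : RubblingMove G} {x : Fin n} →
                                 Balanced S p → t ∈ S → inDegree S x ≡ 0 →
                                 + 0 ≤ applyMove t p x
applyMove-nonneg-if-inDegree≡0 S p {x = x} balanced t∈S d =
  ≤-trans (balanced x) (applyMoves-≤-applyMove S p d t∈S)

mainTheorem2 : {n : ℕ} (G : SimpleGraph n) (p : PebbleFunction n)
    (S : List (RubblingMove G)) (t : RubblingMove G) →
    IsPebbleDistribution p →
    Balanced S p →
    t ∈ S →
    inDegree S (src₁ t) ≡ 0 →
    inDegree S (src₂ t) ≡ 0 →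
    ∀ x → + 0 ≤ applyMove t p x
mainTheorem2 G p S t p≥0 balanced t∈S d-v d-w x with x ≟ src₁ t ⊎-dec x ≟ src₂ t
... | yes (inj₁ refl) = applyMove-nonneg-if-inDegree≡0 S p balanced t∈S d-v
... | yes (inj₂ refl) = applyMove-nonneg-if-inDegree≡0 S p balanced t∈S d-w
... | no  x∉vw       = ≤-trans (p≥0 x) (applyMove-≥ t p (x∉vw ∘′ inj₁) (x∉vw ∘′ inj₂))
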